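{- Let $G$ be a graph of order $n$ and let $\overline{G}$ denote its complement. Then $b^A_g(G)+b^I_g(\overline{G})=\lfloor n/2\rfloor$.
   Context: The balance game on a finite simple graph $G$ is played by two players, Admirable (A) and Impish (I), who alternately select a not-yet-labeled vertex of $G$ until all vertices are labeled; Admirable labels each vertex she selects by $0$ and Impish labels each vertex he selects by $1$. Each edge receives the sum modulo $2$ of the labels of its endpoints. Let $e_0$ and $e_1$ be the numbers of edges labeled $0$ and $1$ at the end; the discrepancy is $d=e_1-e_0$. Admirable tries to minimize $d$ and Impish tries to maximize $d$. $b^A_g(G)$ (the (A)-start game balance number) is the value of $d$ under optimal play of both players when Admirable moves first, and $b^I_g(G)$ (the (I)-start game balance number) is the value under optimal play when Impish moves first. -}

module Defs where

open import Data.Bool using (Bool; true; false; not; if_then_else_; _xor_)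
open import Data.Nat using (ℕ; zero; suc)
open import Data.Fin using (Fin; zero; suc)
open import Data.Fin.Properties using (_≟_; _<?_)
open import Data.Integer using (ℤ; +_; -_; _+_; _⊓_; _⊔_)
open import Data.Vec using (Vec; []; _∷_; lookup; removeAt; allFin)
open import Relation.Nullary using (yes; no; ¬_)
open import Relation.Binary.PropositionalEquality using (_≡_; refl; sym; trans)

record Graph (n : ℕ) : Set where
  field
    adj     : Fin n → Fin n → Bool
    adj-sym : ∀ i j → adj i j ≡ adj j i
    adj-irr : ∀ i → adj i i ≡ false
open Graph public

compAdj : ∀ {n} → Graph n → Fin n → Fin n → Bool
compAdj G i j with i ≟ j
... | yes _ = false
... | no  _ = not (adj G i j)

compAdj-sym : ∀ {n} (G : Graph n) i j → compAdj G i j ≡ compAdj G j i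
compAdj-sym G i j with i ≟ j | j ≟ i
... | yes _ | yes _ = refl
... | yes p | no ¬q = Data.Empty.⊥-elim (¬q (sym p))
  where import Data.Empty
... | no ¬p | yes q = Data.Empty.⊥-elim (¬p (sym q))
  where import Data.Empty
... | no _  | no _  rewrite adj-sym G i j = refl

compAdj-irr : ∀ {n} (G : Graph n) i → compAdj G i i ≡ false
compAdj-irr G i with i ≟ i
... | yes _ = refl
... | no ¬p = Data.Empty.⊥-elim (¬p refl)
  where import Data.Empty

complement : ∀ {n} → Graph n → Graph n
complement G = record { adj = compAdj G ; adj-sym = compAdj-sym G ; adj-irr = compAdj-irr G }

sumFin : ∀ {n} → (Fin n → ℤ) → ℤ
sumFin {zero}  f = + 0
sumFin {suc n} f = f zero + sumFin (λ i → f (suc i))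

-- contribution of an (unordered) pair {i,j}: 0 if not an edge,
-- +1 if the edge is labelled 1 (endpoint labels differ), -1 if labelled 0.
edgeVal : ∀ {n} → Graph n → (Fin n → Bool) → Fin n → Fin n → ℤ
edgeVal G lab i j with i <? j
... | no _  = + 0
... | yes _ = if adj G i j then (if lab i xor lab j then + 1 else - (+ 1)) else + 0

-- discrepancy d = e₁ - e₀ of a complete labelling (false = 0, true = 1)
discrepancy : ∀ {n} → Graph n → (Fin n → Bool) → ℤ
discrepancy G lab = sumFin (λ i → sumFin (λ j → edgeVal G lab i j))

data Player : Set where
  Admirable Impish : Player

minFin maxFin : ∀ {k} → (Fin (suc k) → ℤ) → ℤ
minFin {zero}  f = f zero
minFin {suc k} f = f zero ⊓ minFin (λ i → f (suc i))
maxFin {zero}  f = f zero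
maxFin {suc k} f = f zero ⊔ maxFin (λ i → f (suc i))

update : ∀ {n} → (Fin n → Bool) → Fin n → Bool → Fin n → Bool
update lab v b w with w ≟ v
... | yes _ = b
... | no  _ = lab w

-- value under optimal play, given the player to move, the k unlabelled
-- vertices, and the current labels (only meaningful on labelled vertices).
-- Admirable labels by 0 (false) and minimises; Impish labels by 1 (true) and maximises.
gameValue : ∀ {n} → Graph n → (k : ℕ) → Player → Vec (Fin n) k → (Fin n → Bool) → ℤ
gameValue G zero    _         []  lab = discrepancy G lab
gameValue G (suc k) Admirable vs lab =
  minFin (λ i → gameValue G k Impish (removeAt vs i) (update lab (lookup vs i) false))
gameValue G (suc k) Impish    vs lab =
  maxFin (λ i → gameValue G k Admirable (removeAt vs i) (update lab (lookup vs i) true))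

bA bI : ∀ {n} → Graph n → ℤ
bA {n} G = gameValue G n Admirable (allFin n) (λ _ → false)
bI {n} G = gameValue G n Impish    (allFin n) (λ _ → false)

{-# OPTIONS --safe #-}
module Submission where

-- Flipping all labels turns a play of the game on the complement Ḡ started by Impish into a
-- play of the game on G started by Admirable, each player now making the other's moves. For a
-- complete labelling L with signs sᵢ = ±1, every pair {i,j} is an edge of exactly one of G and Ḡ,
-- and flipping does not change whether its endpoints agree; hence d_G(¬L) + d_Ḡ(L) = −Σ_{i<j} sᵢsⱼ,
-- which by (Σ sᵢ)² = n + 2 Σ_{i<j} sᵢsⱼ is determined by Σ sᵢ = #ones − #zeros. At the end of
-- every play this is ⌈n/2⌉ − ⌊n/2⌋, so the payoffs sum to ⌊n/2⌋. Min and max of two families with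
-- constant sum again have that sum, so the two game values add up to ⌊n/2⌋ at every pair of
-- corresponding positions, in particular at the start.

open import Defs
open import Data.Nat using (ℕ; _/_)
open import Data.Integer using (ℤ; +_; _+_)
open import Relation.Binary.PropositionalEquality using (_≡_)

open import Data.Integer.Properties as ℤ
  using (+-identityˡ; +-identityʳ; +-comm; neg-distrib-+; *-identityˡ; *-zeroʳ; -1*i≡-i; *-cancelˡ-≡;
         antimono-<-distrib-⊓; +-monoˡ-<; neg-mono-<)
open import Algebra.Properties.AbelianGroup ℤ.+-0-abelianGroup
  using (∙-cancelʳ; y≈x\\z; \\-leftDividesˡ)
open import Algebra.Properties.Semiring.Sum ℤ.+-*-semiring
  using (sum; sum-cong-≗; ∑-distrib-+; *-distribˡ-sum; sum-remove)
open import Data.Bool using (Bool; true; false; not)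
open import Data.Fin using (Fin; zero; suc; punchIn; punchOut)
open import Data.Fin.Properties
  using (_≟_; _<?_; <-irrefl; punchIn-injective; punchInᵢ≢i; punchOut-punchIn)
open import Data.Integer using (-_; _*_; _⊓_; _⊔_; _<_)
open import Data.Integer.Tactic.RingSolver using (solve-∀)
open import Data.Nat as ℕ using (zero; suc)
open import Data.Nat.DivMod using (m/n≡1+[m∸n]/n)
open import Data.Vec using (Vec; []; lookup; removeAt; allFin)
open import Data.Vec.Properties using (lookup-allFin; removeAt-punchOut)
open import Function using (_∘_; Injective)
open import Relation.Binary.PropositionalEquality
  using (_≢_; _≗_; refl; sym; trans; cong; cong₂; module ≡-Reasoning)
open import Relation.Nullary using (yes; no; contradiction)

open ≡-Reasoning

sumFin≡sum : ∀ {n} (f : Fin n → ℤ) → sumFin f ≡ sum f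
sumFin≡sum {zero}  f = refl
sumFin≡sum {suc n} f = cong (_+_ (f zero)) (sumFin≡sum (f ∘ suc))

sum-const : ∀ n (x : ℤ) → sum {n} (λ _ → x) ≡ x * + n
sum-const zero    x = sym (*-zeroʳ x)
sum-const (suc n) x = trans (cong (_+_ x) (sum-const n x)) (x+x*m≡x*[1+m] x (+ n))
  where
  x+x*m≡x*[1+m] : ∀ x m → x + x * m ≡ x * (+ 1 + m)
  x+x*m≡x*[1+m] = solve-∀

sum-neg : ∀ {n} (f : Fin n → ℤ) → sum (λ i → - f i) ≡ - sum f
sum-neg {zero}  f = refl
sum-neg {suc n} f =
  trans (cong (_+_ (- f zero)) (sum-neg (f ∘ suc))) (sym (neg-distrib-+ (f zero) (sum (f ∘ suc))))

strictUpper : ∀ {n} → (Fin n → Fin n → ℤ) → Fin n → Fin n → ℤ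
strictUpper h i j with i <? j
... | yes _ = h i j
... | no  _ = + 0

strictUpper-suc : ∀ {n} (h : Fin (suc n) → Fin (suc n) → ℤ) i j →
                  strictUpper h (suc i) (suc j) ≡ strictUpper (λ a b → h (suc a) (suc b)) i j
strictUpper-suc h i j with suc i <? suc j | i <? j
... | yes _   | yes _   = refl
... | no  _   | no  _   = refl
... | yes i<j | no  i≮j = contradiction (ℕ.s≤s⁻¹ i<j) i≮j
... | no  i≮j | yes i<j = contradiction (ℕ.s≤s i<j) i≮j

sumPairs : ∀ {n} → (Fin n → Fin n → ℤ) → ℤ
sumPairs h = sum (λ i → sum (λ j → strictUpper h i j))

sumPairs-suc : ∀ {n} (h : Fin (suc n) → Fin (suc n) → ℤ) →
               sumPairs h ≡ sum (λ j → h zero (suc j)) + sumPairs (λ a b → h (suc a) (suc b))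
-- The comparisons involving zero compute, leaving only the + 0 summands to drop.
sumPairs-suc h = cong₂ _+_
  (+-identityˡ (sum (λ j → h zero (suc j))))
  (sum-cong-≗ (λ i → trans (+-identityˡ (sum (λ j → strictUpper h (suc i) (suc j))))
                           (sum-cong-≗ (strictUpper-suc h i))))

sum-square : ∀ {n} (f : Fin n → ℤ) →
             sum f * sum f ≡ sum (λ i → f i * f i) + + 2 * sumPairs (λ i j → f i * f j)
sum-square {zero}  f = refl
sum-square {suc n} f = begin
  (a + S) * (a + S)
    ≡⟨ expand a S ⟩
  a * a + + 2 * (a * S) + S * S
    ≡⟨ cong (_+_ (a * a + + 2 * (a * S))) (sum-square (f ∘ suc)) ⟩
  a * a + + 2 * (a * S) + (Q + + 2 * P)
    ≡⟨ regroup (a * a) (a * S) Q P ⟩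
  a * a + Q + + 2 * (a * S + P)
    ≡⟨ cong (λ x → a * a + Q + + 2 * (x + P)) (*-distribˡ-sum a (f ∘ suc)) ⟩
  a * a + Q + + 2 * (sum (λ j → a * f (suc j)) + P)
    ≡⟨ cong (λ x → a * a + Q + + 2 * x) (sumPairs-suc (λ i j → f i * f j)) ⟨
  a * a + Q + + 2 * sumPairs (λ i j → f i * f j) ∎
  where
  a = f zero
  S = sum (f ∘ suc)
  Q = sum (λ i → f (suc i) * f (suc i))
  P = sumPairs (λ i j → f (suc i) * f (suc j))
  expand : ∀ a S → (a + S) * (a + S) ≡ a * a + + 2 * (a * S) + S * S
  expand = solve-∀
  regroup : ∀ a² aS Q P → a² + + 2 * aS + (Q + + 2 * P) ≡ a² + Q + + 2 * (aS + P)
  regroup = solve-∀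

sign : Bool → ℤ
sign false = - + 1
sign true  = + 1

sign-square : ∀ b → sign b * sign b ≡ + 1
sign-square false = refl
sign-square true  = refl

onesMinusZeros : ∀ {n} → (Fin n → Bool) → ℤ
onesMinusZeros L = sum (sign ∘ L)

onesMinusZeros-allFalse : ∀ n → onesMinusZeros {n} (λ _ → false) ≡ - + n
onesMinusZeros-allFalse n = trans (sum-const n (- + 1)) (-1*i≡-i (+ n))

update-updates : ∀ {n} (lab : Fin n → Bool) v b → update lab v b v ≡ b
update-updates lab v b with v ≟ v
... | yes _   = refl
... | no  v≢v = contradiction refl v≢v

update-minimal : ∀ {n} (lab : Fin n → Bool) {v w} b → w ≢ v → update lab v b w ≡ lab w
update-minimal lab {v} {w} b w≢v with w ≟ v
... | yes w≡v = contradiction w≡v w≢v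
... | no  _   = refl

onesMinusZeros-update : ∀ {n} (lab : Fin n → Bool) v b → lab v ≡ false →
                        onesMinusZeros (update lab v b) ≡ onesMinusZeros lab + (sign b + + 1)
onesMinusZeros-update {suc n} lab v b labᵥ≡false = begin
  sum (sign ∘ update lab v b)              ≡⟨ sum-remove {i = v} (sign ∘ update lab v b) ⟩
  sign (update lab v b v) + R′             ≡⟨ cong₂ _+_ (cong sign (update-updates lab v b)) R′≡R ⟩
  sign b + R                               ≡⟨ shift (sign b) R ⟩
  (sign false + R) + (sign b + + 1)        ≡⟨ cong (λ x → (sign x + R) + (sign b + + 1)) labᵥ≡false ⟨
  (sign (lab v) + R) + (sign b + + 1)      ≡⟨ cong (_+ (sign b + + 1)) (sum-remove {i = v} (sign ∘ lab)) ⟨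
  sum (sign ∘ lab) + (sign b + + 1)        ∎
  where
  R′ = sum (λ j → sign (update lab v b (punchIn v j)))
  R  = sum (λ j → sign (lab (punchIn v j)))
  R′≡R : R′ ≡ R
  R′≡R = sum-cong-≗ (λ j → cong sign (update-minimal lab b (punchInᵢ≢i v j)))
  shift : ∀ s r → s + r ≡ (- + 1 + r) + (s + + 1)
  shift = solve-∀

discrepancy≡sum : ∀ {n} (G : Graph n) lab →
                  discrepancy G lab ≡ sum (λ i → sum (λ j → edgeVal G lab i j))
discrepancy≡sum G lab =
  trans (sumFin≡sum (λ i → sumFin (λ j → edgeVal G lab i j)))
        (sum-cong-≗ (λ i → sumFin≡sum (λ j → edgeVal G lab i j)))

discrepancy-cong : ∀ {n} (G : Graph n) {L L′ : Fin n → Bool} → L ≗ L′ →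
                   discrepancy G L ≡ discrepancy G L′
discrepancy-cong G {L} {L′} L≗L′ = begin
  discrepancy G L                                  ≡⟨ discrepancy≡sum G L ⟩
  sum (λ i → sum (λ j → edgeVal G L i j))          ≡⟨ sum-cong-≗ (λ i → sum-cong-≗ (edgeVal-cong i)) ⟩
  sum (λ i → sum (λ j → edgeVal G L′ i j))         ≡⟨ discrepancy≡sum G L′ ⟨
  discrepancy G L′                                 ∎
  where
  edgeVal-cong : ∀ i j → edgeVal G L i j ≡ edgeVal G L′ i j
  edgeVal-cong i j with i <? j
  ... | no  _ = refl
  ... | yes _ rewrite L≗L′ i | L≗L′ j = refl

edgeVal-flip+complement : ∀ {n} (G : Graph n) (L : Fin n → Bool) i j →
  edgeVal G (not ∘ L) i j + edgeVal (complement G) L i j ≡ - strictUpper (λ a b → sign (L a) * sign (L b)) i j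
edgeVal-flip+complement G L i j with i <? j
... | no  _   = refl
... | yes i<j with i ≟ j
...   | yes refl = contradiction i<j (<-irrefl refl)
...   | no  _ with adj G i j | L i | L j
...     | true  | true  | true  = refl
...     | true  | true  | false = refl
...     | true  | false | true  = refl
...     | true  | false | false = refl
...     | false | true  | true  = refl
...     | false | true  | false = refl
...     | false | false | true  = refl
...     | false | false | false = refl

discrepancy-flip+complement : ∀ {n} (G : Graph n) (L : Fin n → Bool) →
  discrepancy G (not ∘ L) + discrepancy (complement G) L ≡ - sumPairs (λ i j → sign (L i) * sign (L j))
discrepancy-flip+complement G L = begin
  discrepancy G (not ∘ L) + discrepancy (complement G) L
    ≡⟨ cong₂ _+_ (discrepancy≡sum G (not ∘ L)) (discrepancy≡sum (complement G) L) ⟩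
  sum (λ i → sum (e i)) + sum (λ i → sum (ē i))
    ≡⟨ ∑-distrib-+ (λ i → sum (e i)) (λ i → sum (ē i)) ⟨
  sum (λ i → sum (e i) + sum (ē i))
    ≡⟨ sum-cong-≗ (λ i → ∑-distrib-+ (e i) (ē i)) ⟨
  sum (λ i → sum (λ j → e i j + ē i j))
    ≡⟨ sum-cong-≗ (λ i → sum-cong-≗ (edgeVal-flip+complement G L i)) ⟩
  sum (λ i → sum (λ j → - strictUpper σσ i j))
    ≡⟨ sum-cong-≗ (λ i → sum-neg (strictUpper σσ i)) ⟩
  sum (λ i → - sum (strictUpper σσ i))
    ≡⟨ sum-neg (λ i → sum (strictUpper σσ i)) ⟩
  - sumPairs σσ ∎
  where
  e ē : Fin _ → Fin _ → ℤ
  e = edgeVal G (not ∘ L)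
  ē = edgeVal (complement G) L
  σσ : Fin _ → Fin _ → ℤ
  σσ i j = sign (L i) * sign (L j)

discrepancy-duality : ∀ {n} (G : Graph n) (L : Fin n → Bool) →
  + 2 * (discrepancy G (not ∘ L) + discrepancy (complement G) L) + onesMinusZeros L * onesMinusZeros L ≡ + n
discrepancy-duality {n} G L = begin
  + 2 * (discrepancy G (not ∘ L) + discrepancy (complement G) L) + onesMinusZeros L * onesMinusZeros L
    ≡⟨ cong₂ (λ d s → + 2 * d + s) (discrepancy-flip+complement G L) (sum-square (sign ∘ L)) ⟩
  + 2 * - P + (sum (λ i → sign (L i) * sign (L i)) + + 2 * P)
    ≡⟨ cong (λ s → + 2 * - P + (s + + 2 * P)) (trans (sum-cong-≗ (sign-square ∘ L)) (sum-const n (+ 1))) ⟩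
  + 2 * - P + (+ 1 * + n + + 2 * P)
    ≡⟨ cancel P (+ 1 * + n) ⟩
  + 1 * + n
    ≡⟨ *-identityˡ (+ n) ⟩
  + n ∎
  where
  P = sumPairs (λ i j → sign (L i) * sign (L j))
  cancel : ∀ p m → + 2 * - p + (m + + 2 * p) ≡ m
  cancel = solve-∀

⊓-+-⊔-complementary : ∀ a a′ b b′ {c : ℤ} → a + b ≡ c → a′ + b′ ≡ c → a ⊓ a′ + (b ⊔ b′) ≡ c
⊓-+-⊔-complementary a a′ b b′ {c} a+b≡c a′+b′≡c = begin
  a ⊓ a′ + (b ⊔ b′)
    ≡⟨ cong₂ (λ x y → a ⊓ a′ + (x ⊔ y)) (y≈x\\z a b c a+b≡c) (y≈x\\z a′ b′ c a′+b′≡c) ⟩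
  a ⊓ a′ + ((- a + c) ⊔ (- a′ + c))
    ≡⟨ cong (_+_ (a ⊓ a′)) (antimono-<-distrib-⊓ (λ x → - x + c) c-mono a a′) ⟨
  a ⊓ a′ + (- (a ⊓ a′) + c)
    ≡⟨ \\-leftDividesˡ (a ⊓ a′) c ⟩
  c ∎
  where
  c-mono : ∀ {x y} → x < y → - y + c < - x + c
  c-mono x<y = +-monoˡ-< c (neg-mono-< x<y)

minFin+maxFin : ∀ {k} (f g : Fin (suc k) → ℤ) {c} → (∀ i → f i + g i ≡ c) → minFin f + maxFin g ≡ c
minFin+maxFin {zero}  f g f+g≡c = f+g≡c zero
minFin+maxFin {suc k} f g f+g≡c =
  ⊓-+-⊔-complementary (f zero) (minFin (f ∘ suc)) (g zero) (maxFin (g ∘ suc))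
    (f+g≡c zero) (minFin+maxFin (f ∘ suc) (g ∘ suc) (f+g≡c ∘ suc))

maxFin+minFin : ∀ {k} (f g : Fin (suc k) → ℤ) {c} → (∀ i → f i + g i ≡ c) → maxFin f + minFin g ≡ c
maxFin+minFin f g f+g≡c =
  trans (+-comm (maxFin f) (minFin g)) (minFin+maxFin g f (λ i → trans (+-comm (g i) (f i)) (f+g≡c i)))

lookup-removeAt : ∀ {A : Set} {k} (xs : Vec A (suc k)) i j →
                  lookup (removeAt xs i) j ≡ lookup xs (punchIn i j)
lookup-removeAt xs i j = trans (cong (lookup (removeAt xs i)) (sym (punchOut-punchIn i)))
                               (removeAt-punchOut xs (punchInᵢ≢i i j ∘ sym))

opponent : Player → Player
opponent Admirable = Impish
opponent Impish    = Admirable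

impishMoves : ℕ → Player → ℕ
impishMoves zero    _         = 0
impishMoves (suc k) Admirable = impishMoves k Impish
impishMoves (suc k) Impish    = suc (impishMoves k Admirable)

-- Unselected vertices carry the junk label false in lab, so they count as zeros in
-- onesMinusZeros lab; lab′ need only be the flip of lab on the selected vertices.
record Mirrored {n k} (vs : Vec (Fin n) k) (lab lab′ : Fin n → Bool) : Set where
  field
    distinct   : Injective _≡_ _≡_ (lookup vs)
    unlabelled : ∀ i → lab (lookup vs i) ≡ false
    flipped    : ∀ w → (∀ i → lookup vs i ≢ w) → lab′ w ≡ not (lab w)
open Mirrored

Mirrored-move : ∀ {n k} {vs : Vec (Fin n) (suc k)} {lab lab′} → Mirrored vs lab lab′ → ∀ i b →
                Mirrored (removeAt vs i) (update lab (lookup vs i) b) (update lab′ (lookup vs i) (not b))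
Mirrored-move {vs = vs} {lab} {lab′} m i b = record
  { distinct   = λ {j} {j′} eq → punchIn-injective i j j′
                   (distinct m (trans (sym (lookup-removeAt vs i j)) (trans eq (lookup-removeAt vs i j′))))
  ; unlabelled = unlabelled′
  ; flipped    = flipped′
  }
  where
  remaining≢moved : ∀ j → lookup (removeAt vs i) j ≢ lookup vs i
  remaining≢moved j eq = punchInᵢ≢i i j (distinct m (trans (sym (lookup-removeAt vs i j)) eq))
  unlabelled′ : ∀ j → update lab (lookup vs i) b (lookup (removeAt vs i) j) ≡ false
  unlabelled′ j = begin
    update lab (lookup vs i) b (lookup (removeAt vs i) j) ≡⟨ update-minimal lab b (remaining≢moved j) ⟩
    lab (lookup (removeAt vs i) j)                        ≡⟨ cong lab (lookup-removeAt vs i j) ⟩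
    lab (lookup vs (punchIn i j))                         ≡⟨ unlabelled m (punchIn i j) ⟩
    false                                                 ∎
  avoided : ∀ w → (∀ j → lookup (removeAt vs i) j ≢ w) → lookup vs i ≢ w → ∀ l → lookup vs l ≢ w
  avoided w w∉vs′ vᵢ≢w l with i ≟ l
  ... | yes refl = vᵢ≢w
  ... | no  i≢l  = w∉vs′ (punchOut i≢l) ∘ trans (removeAt-punchOut vs i≢l)
  flipped′ : ∀ w → (∀ j → lookup (removeAt vs i) j ≢ w) →
             update lab′ (lookup vs i) (not b) w ≡ not (update lab (lookup vs i) b w)
  flipped′ w w∉vs′ with w ≟ lookup vs i
  ... | yes _   = refl
  ... | no  w≢v = flipped m w (avoided w w∉vs′ (w≢v ∘ sym))

module _ {n} (G H : Graph n) (t c : ℤ)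
         (payoff-sum : ∀ L → onesMinusZeros L ≡ t → discrepancy G (not ∘ L) + discrepancy H L ≡ c) where

  -- t is the value of onesMinusZeros at the end of every play: each of Impish's remaining
  -- moves turns a 0 into a 1, while Admirable's moves keep a 0.
  gameValue-sum : ∀ k pl (vs : Vec (Fin n) k) lab lab′ → Mirrored vs lab lab′ →
                  onesMinusZeros lab + + 2 * + impishMoves k pl ≡ t →
                  gameValue G k (opponent pl) vs lab′ + gameValue H k pl vs lab ≡ c
  gameValue-sum zero pl [] lab lab′ m balance = begin
    discrepancy G lab′ + discrepancy H lab
      ≡⟨ cong (_+ discrepancy H lab) (discrepancy-cong G (λ w → flipped m w λ ())) ⟩
    discrepancy G (not ∘ lab) + discrepancy H lab
      ≡⟨ payoff-sum lab (trans (sym (+-identityʳ _)) balance) ⟩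
    c ∎
  gameValue-sum (suc k) Impish vs lab lab′ m balance =
    minFin+maxFin _ _ λ i →
      gameValue-sum k Admirable (removeAt vs i) _ _ (Mirrored-move m i true) (balance′ i)
    where
    balance′ : ∀ i → onesMinusZeros (update lab (lookup vs i) true) + + 2 * + impishMoves k Admirable ≡ t
    balance′ i = begin
      onesMinusZeros (update lab (lookup vs i) true) + + 2 * + impishMoves k Admirable
        ≡⟨ cong (_+ _) (onesMinusZeros-update lab (lookup vs i) true (unlabelled m i)) ⟩
      onesMinusZeros lab + + 2 + + 2 * + impishMoves k Admirable
        ≡⟨ shift (onesMinusZeros lab) (+ impishMoves k Admirable) ⟩
      onesMinusZeros lab + + 2 * + impishMoves (suc k) Impish
        ≡⟨ balance ⟩
      t ∎
      where
      shift : ∀ x m → x + + 2 + + 2 * m ≡ x + + 2 * (+ 1 + m)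
      shift = solve-∀
  gameValue-sum (suc k) Admirable vs lab lab′ m balance =
    maxFin+minFin _ _ λ i →
      gameValue-sum k Impish (removeAt vs i) _ _ (Mirrored-move m i false) (balance′ i)
    where
    balance′ : ∀ i → onesMinusZeros (update lab (lookup vs i) false) + + 2 * + impishMoves k Impish ≡ t
    balance′ i = begin
      onesMinusZeros (update lab (lookup vs i) false) + + 2 * + impishMoves k Impish
        ≡⟨ cong (_+ _) (onesMinusZeros-update lab (lookup vs i) false (unlabelled m i)) ⟩
      onesMinusZeros lab + + 0 + + 2 * + impishMoves k Impish
        ≡⟨ cong (_+ _) (+-identityʳ (onesMinusZeros lab)) ⟩
      onesMinusZeros lab + + 2 * + impishMoves (suc k) Admirable
        ≡⟨ balance ⟩
      t ∎

-- This is n mod 2: Impish makes ⌈n/2⌉ of the n moves of the game he starts.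
finalOnesMinusZeros : ℕ → ℤ
finalOnesMinusZeros n = - + n + + 2 * + impishMoves n Impish

⌊n/2⌋-square-identity : ∀ n → + 2 * + (n / 2) + finalOnesMinusZeros n * finalOnesMinusZeros n ≡ + n
⌊n/2⌋-square-identity zero          = refl
⌊n/2⌋-square-identity (suc zero)    = refl
⌊n/2⌋-square-identity (suc (suc n)) = begin
  + 2 * + (suc (suc n) / 2) + s * s  ≡⟨ cong (λ q → + 2 * + q + s * s) [2+n]/2≡1+n/2 ⟩
  + 2 * (+ 1 + + (n / 2)) + s * s    ≡⟨ shift (+ (n / 2)) (+ n) (+ impishMoves n Impish) ⟩
  + 2 + (+ 2 * + (n / 2) + s′ * s′)  ≡⟨ cong (_+_ (+ 2)) (⌊n/2⌋-square-identity n) ⟩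
  + 2 + + n                          ∎
  where
  s  = finalOnesMinusZeros (suc (suc n))
  s′ = finalOnesMinusZeros n
  [2+n]/2≡1+n/2 : suc (suc n) / 2 ≡ suc (n / 2)
  [2+n]/2≡1+n/2 = m/n≡1+[m∸n]/n {suc (suc n)} (ℕ.s≤s (ℕ.s≤s ℕ.z≤n))
  shift : ∀ q m i → + 2 * (+ 1 + q) + (- (+ 2 + m) + + 2 * (+ 1 + i)) * (- (+ 2 + m) + + 2 * (+ 1 + i))
                    ≡ + 2 + (+ 2 * q + (- m + + 2 * i) * (- m + + 2 * i))
  shift = solve-∀

final-discrepancy-sum : ∀ {n} (G : Graph n) L → onesMinusZeros L ≡ finalOnesMinusZeros n →
                        discrepancy G (not ∘ L) + discrepancy (complement G) L ≡ + (n / 2)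
final-discrepancy-sum {n} G L L-final = *-cancelˡ-≡ (+ 2) _ _ (∙-cancelʳ (s * s) _ _ (begin
  + 2 * (discrepancy G (not ∘ L) + discrepancy (complement G) L) + s * s
    ≡⟨ cong (λ x → + 2 * (discrepancy G (not ∘ L) + discrepancy (complement G) L) + x * x) L-final ⟨
  + 2 * (discrepancy G (not ∘ L) + discrepancy (complement G) L) + onesMinusZeros L * onesMinusZeros L
    ≡⟨ discrepancy-duality G L ⟩
  + n
    ≡⟨ ⌊n/2⌋-square-identity n ⟨
  + 2 * + (n / 2) + s * s ∎))
  where
  s = finalOnesMinusZeros n

Mirrored-start : ∀ n → Mirrored (allFin n) (λ _ → false) (λ _ → false)
Mirrored-start n = record
  { distinct   = λ {i} {j} eq → trans (sym (lookup-allFin i)) (trans eq (lookup-allFin j))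
  ; unlabelled = λ _ → refl
  ; flipped    = λ w w∉allFin → contradiction (lookup-allFin w) (w∉allFin w)
  }

theorem2p2 : (n : ℕ) (G : Graph n) → bA G + bI (complement G) ≡ + (n / 2)
theorem2p2 n G =
  gameValue-sum G (complement G) (finalOnesMinusZeros n) (+ (n / 2)) (final-discrepancy-sum G)
    n Impish (allFin n) (λ _ → false) (λ _ → false) (Mirrored-start n)
    (cong (_+ + 2 * + impishMoves n Impish) (onesMinusZeros-allFalse n))
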